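{- Let $q$ be a prime power and let $d \ge 2$ be a divisor of $q-1$. Let $EA(q) \rtimes C_d$ denote the subgroup of $\mathrm{Aff}(q)$ consisting of the maps $x \mapsto ax + b$ with $b \in GF(q)$ and $a$ in the unique subgroup of order $d$ of $GF(q)^*$. Then $EA(q) \rtimes C_d$ contains a $(qd, 2q-1, \frac{4(q-1)}{d})$ sum set.
   Context: $\mathrm{Aff}(q)$ is the group, under composition, of all maps $GF(q)\to GF(q)$ of the form $x \mapsto ax + b$ with $a \in GF(q)^*$, $b \in GF(q)$. For a finite group $X$ of order $w$, $T\subseteq X$ with $|T|=k$ is a $(w,k,\mu)$ sum set if every nonidentity element $a\in X$ admits exactly $\mu$ ordered pairs $(y_1,y_2)\in T\times T$ with $y_1y_2 = a$. -}

module Defs where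

open import Level using (Level; _⊔_) renaming (suc to lsuc)
open import Data.Nat using (ℕ; zero; suc; _≤_; _^_)
open import Data.Nat.Primality using (Prime)
open import Data.Product using (_×_; _,_; ∃; ∃-syntax; proj₁; proj₂)
open import Data.List using (List; length; filter; cartesianProductWith)
open import Data.List.Relation.Unary.All using (All)
open import Data.List.Relation.Unary.Any using (Any)
open import Data.List.Relation.Unary.AllPairs using (AllPairs)
open import Relation.Nullary using (¬_; Dec; _×-dec_)
open import Relation.Binary using (Decidable)
open import Relation.Binary.PropositionalEquality using (_≡_)
open import Algebra.Bundles using (CommutativeRing)

IsPrimePower : ℕ → Set
IsPrimePower q = ∃[ p ] ∃[ k ] (Prime p × 1 ≤ k × q ≡ p ^ k)

record FiniteField (c ℓ : Level) : Set (lsuc (c ⊔ ℓ)) where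
  field
    commRing : CommutativeRing c ℓ
  open CommutativeRing commRing public
  field
    0≉1      : ¬ (0# ≈ 1#)
    inverse  : ∀ x → ¬ (x ≈ 0#) → ∃[ y ] (x * y ≈ 1#)
    _≟_      : Decidable _≈_
    elements : List Carrier
    complete : ∀ x → Any (x ≈_) elements
    distinct : AllPairs (λ x y → ¬ (x ≈ y)) elements

  size : ℕ
  size = length elements

  pow : Carrier → ℕ → Carrier
  pow x zero    = 1#
  pow x (suc n) = x * pow x n

module AffineGroup {c ℓ : Level} (F : FiniteField c ℓ) (d : ℕ) where
  open FiniteField F

  -- (a , b) represents the affine map x ↦ a x + b
  Aff : Set c
  Aff = Carrier × Carrier

  -- membership in EA(q) ⋊ C_d : a lies in the subgroup of order d of GF(q)^*,
  -- i.e. the set of d-th roots of unity (d ∣ q - 1)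
  InG : Aff → Set ℓ
  InG (a , b) = pow a d ≈ 1#

  _≈A_ : Aff → Aff → Set ℓ
  (a , b) ≈A (a' , b') = (a ≈ a') × (b ≈ b')

  _≟A_ : Decidable _≈A_
  (a , b) ≟A (a' , b') = (a ≟ a') ×-dec (b ≟ b')

  -- composition: (f ∘ g)(x) = f (g x);  a(a'x + b') + b = (a a') x + (a b' + b)
  _∘A_ : Aff → Aff → Aff
  (a , b) ∘A (a' , b') = (a * a' , a * b' + b)

  idA : Aff
  idA = (1# , 0#)

  reps : List Aff → Aff → ℕ
  reps T g = length (filter (λ p → (proj₁ p ∘A proj₂ p) ≟A g)
                            (cartesianProductWith _,_ T T))

  IsSumSet : List Aff → ℕ → ℕ → Set (c ⊔ ℓ)
  IsSumSet T k μ =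
    All InG T × AllPairs (λ x y → ¬ (x ≈A y)) T × length T ≡ k ×
    (∀ g → InG g → ¬ (g ≈A idA) → reps T g ≡ μ)

module Submission where

-- Take T = {id} ∪ μ × D, where μ = C_d and D contains exactly two units from each coset of μ,
-- so that |D| = 2(q-1)/d and |T| = 2q-1. The equation c·y = z (y, z units) has exactly one
-- solution c ∈ μ if yᵈ = zᵈ and none otherwise; hence every unit is a product c·y with c ∈ μ,
-- y ∈ D in exactly two ways. For g = (a, b) ≠ id the products id∘y and x∘id contribute
-- [b ∈ D] each, while (c₁, b₁)∘(c₂, b₂) = g amounts to c₁b₂ = b - b₁, which has 2·[b₁ ≠ b]
-- solutions for each b₁ ∈ D: in total 2|D| = 4(q-1)/d. That |μ| = d follows from the root
-- bound for Xᵈ - 1 together with Fermat's little theorem, by which x ↦ xᵈ maps the q-1 units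
-- into the m-th roots of unity with fibres of size |μ|.

open import Level using (Level)
open import Data.Bool using (if_then_else_)
open import Data.Empty using (⊥-elim)
open import Data.List using (List; []; _∷_; _++_; map; length; filter; replicate; cartesianProduct)
open import Data.List.Properties using (length-replicate)
open import Data.List.Relation.Unary.All using (All; []; _∷_)
import Data.List.Relation.Unary.All as All
import Data.List.Relation.Unary.All.Properties as AllProperties
open import Data.List.Relation.Unary.AllPairs using (AllPairs; []; _∷_)
import Data.List.Relation.Unary.AllPairs.Properties as AllPairsProperties
open import Data.List.Relation.Unary.Any using (Any; here; there)
import Data.List.Relation.Unary.Any as Any
open import Data.List.Relation.Unary.Unique.Setoid using (Unique)
import Data.List.Relation.Unary.Unique.Setoid.Properties as UniqueProperties
import Data.List.Membership.Setoid as SetoidMembership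
import Data.List.Membership.Setoid.Properties as SetoidMembershipProperties
open import Data.Maybe using (nothing)
open import Data.Nat using (ℕ; zero; suc; NonZero; _≤_; _<_; _<?_; _⊓_; _∸_; s≤s; z≤n)
  renaming (_+_ to _+ℕ_; _*_ to _*ℕ_)
import Data.Nat.Properties as ℕ
open import Data.Nat.Tactic.RingSolver using (solve-∀)
open import Data.Product using (_×_; _,_; proj₁; proj₂; ∃-syntax)
open import Data.Product.Relation.Binary.Pointwise.NonDependent using (_×ₛ_)
open import Function using (_∘_; id)
open import Function.Definitions using (Congruent; Injective)
open import Relation.Nullary using (¬_; Dec; yes; no; does; ¬?; _×-dec_)
open import Relation.Unary using (Pred; Decidable)
open import Relation.Binary.Bundles using (Setoid; DecSetoid)
open import Relation.Binary.Definitions using (_Respects_)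
open import Relation.Binary.PropositionalEquality using (_≡_)
import Relation.Binary.PropositionalEquality as ≡
import Relation.Binary.Reasoning.Setoid as ≈-Reasoning
open import Algebra.Bundles using (CommutativeMonoid)
import Algebra.Properties.CommutativeSemigroup as CommutativeSemigroupProperties
import Algebra.Properties.CommutativeSemiring.Exp as ExpProperties
import Algebra.Properties.Group as GroupProperties
import Tactic.RingSolver.Core.AlmostCommutativeRing as ACR
import Tactic.RingSolver.NonReflective as RingSolver

open import Defs

module BigOperator {c ℓ} (M : CommutativeMonoid c ℓ) where
  open CommutativeMonoid M
  open CommutativeSemigroupProperties commutativeSemigroup using (interchange)
  open ≈-Reasoning setoid

  private variable
    a b p : Level
    A : Set a
    B : Set b

  ∏ : List A → (A → Carrier) → Carrier
  ∏ []       f = ε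
  ∏ (x ∷ xs) f = f x ∙ ∏ xs f

  when : {P : Set p} → Dec P → Carrier → Carrier
  when P? z = if does P? then z else ε

  ∏-cong : ∀ (xs : List A) {f g : A → Carrier} → (∀ x → f x ≈ g x) → ∏ xs f ≈ ∏ xs g
  ∏-cong []       f≈g = refl
  ∏-cong (x ∷ xs) f≈g = ∙-cong (f≈g x) (∏-cong xs f≈g)

  ∏-congᴬ : ∀ {xs : List A} {f g : A → Carrier} → All (λ x → f x ≈ g x) xs → ∏ xs f ≈ ∏ xs g
  ∏-congᴬ []           = refl
  ∏-congᴬ (fx≈gx ∷ eqs) = ∙-cong fx≈gx (∏-congᴬ eqs)

  ∏-ε : ∀ (xs : List A) → ∏ xs (λ _ → ε) ≈ ε
  ∏-ε []       = refl
  ∏-ε (x ∷ xs) = trans (identityˡ _) (∏-ε xs)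

  ∏-∙ : ∀ (xs : List A) (f g : A → Carrier) → ∏ xs (λ x → f x ∙ g x) ≈ ∏ xs f ∙ ∏ xs g
  ∏-∙ []       f g = sym (identityˡ ε)
  ∏-∙ (x ∷ xs) f g = begin
    (f x ∙ g x) ∙ ∏ xs (λ x → f x ∙ g x) ≈⟨ ∙-cong refl (∏-∙ xs f g) ⟩
    (f x ∙ g x) ∙ (∏ xs f ∙ ∏ xs g)      ≈⟨ interchange (f x) (g x) (∏ xs f) (∏ xs g) ⟩
    (f x ∙ ∏ xs f) ∙ (g x ∙ ∏ xs g)      ∎

  ∏-++ : ∀ (xs ys : List A) (f : A → Carrier) → ∏ (xs ++ ys) f ≈ ∏ xs f ∙ ∏ ys f
  ∏-++ []       ys f = sym (identityˡ _)
  ∏-++ (x ∷ xs) ys f = trans (∙-cong refl (∏-++ xs ys f)) (sym (assoc _ _ _))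

  ∏-map : ∀ (g : A → B) (xs : List A) (f : B → Carrier) → ∏ (map g xs) f ≡ ∏ xs (λ x → f (g x))
  ∏-map g []       f = ≡.refl
  ∏-map g (x ∷ xs) f = ≡.cong (f (g x) ∙_) (∏-map g xs f)

  ∏-cartesianProduct : ∀ (xs : List A) (ys : List B) (f : A × B → Carrier) →
    ∏ (cartesianProduct xs ys) f ≈ ∏ xs (λ x → ∏ ys (λ y → f (x , y)))
  ∏-cartesianProduct []       ys f = refl
  ∏-cartesianProduct (x ∷ xs) ys f = begin
    ∏ (map (x ,_) ys ++ cartesianProduct xs ys) f           ≈⟨ ∏-++ (map (x ,_) ys) _ f ⟩
    ∏ (map (x ,_) ys) f ∙ ∏ (cartesianProduct xs ys) f      ≡⟨ ≡.cong (_∙ _) (∏-map (x ,_) ys f) ⟩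
    ∏ ys (λ y → f (x , y)) ∙ ∏ (cartesianProduct xs ys) f   ≈⟨ ∙-cong refl (∏-cartesianProduct xs ys f) ⟩
    ∏ ys (λ y → f (x , y)) ∙ ∏ xs (λ x → ∏ ys (λ y → f (x , y))) ∎

  ∏-swap : ∀ (xs : List A) (ys : List B) (f : A → B → Carrier) →
    ∏ xs (λ x → ∏ ys (f x)) ≈ ∏ ys (λ y → ∏ xs (λ x → f x y))
  ∏-swap []       ys f = sym (∏-ε ys)
  ∏-swap (x ∷ xs) ys f = begin
    ∏ ys (f x) ∙ ∏ xs (λ x → ∏ ys (f x))         ≈⟨ ∙-cong refl (∏-swap xs ys f) ⟩
    ∏ ys (f x) ∙ ∏ ys (λ y → ∏ xs (λ x → f x y)) ≈⟨ sym (∏-∙ ys (f x) _) ⟩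
    ∏ ys (λ y → ∏ (x ∷ xs) (λ x → f x y))        ∎

  module _ {a ℓa} (S : Setoid a ℓa) {P : Pred (Setoid.Carrier S) p} (P? : Decidable P) where
    private
      module S = Setoid S

    ∏-when-none : ∀ {xs} (h : S.Carrier → Carrier) → All (λ x → ¬ P x) xs →
      ∏ xs (λ x → when (P? x) (h x)) ≈ ε
    ∏-when-none h []             = refl
    ∏-when-none {x ∷ xs} h (¬Px ∷ ¬Pxs) with P? x
    ... | yes Px = ⊥-elim (¬Px Px)
    ... | no  _  = trans (identityˡ _) (∏-when-none h ¬Pxs)

    ∏-when-unique : ∀ {xs s} (h : S.Carrier → Carrier) → Unique S xs → Any P xs →
      P s → (∀ {x} → P x → x S.≈ s) → (∀ {x} → P x → h x ≈ h s) →
      ∏ xs (λ x → when (P? x) (h x)) ≈ h s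
    ∏-when-unique {x ∷ xs} {s} h (x∉xs ∷ !xs) ∃P Ps unique h-resp with P? x | ∃P
    ... | yes Px | _ = begin
      h x ∙ ∏ xs (λ x → when (P? x) (h x)) ≈⟨ ∙-cong (h-resp Px) (∏-when-none h (All.map ¬P x∉xs)) ⟩
      h s ∙ ε                               ≈⟨ identityʳ (h s) ⟩
      h s                                   ∎
      where
      ¬P : ∀ {y} → ¬ x S.≈ y → ¬ P y
      ¬P x≉y Py = x≉y (S.trans (unique Px) (S.sym (unique Py)))
    ... | no ¬Px | here Px   = ⊥-elim (¬Px Px)
    ... | no _   | there ∃P′ = trans (identityˡ _) (∏-when-unique h !xs ∃P′ Ps unique h-resp)

  module _ {a ℓa} (S : DecSetoid a ℓa) where
    private
      module S = DecSetoid S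
    open SetoidMembership S.setoid using (_∈_)

    -- Both sides are the product of g y over the pairs (x , y) of elements of xs with y ≈ φ x.
    ∏-permute : ∀ {xs} (φ : S.Carrier → S.Carrier) (g : S.Carrier → Carrier) →
      Unique S.setoid xs → Congruent S._≈_ S._≈_ φ → Injective S._≈_ S._≈_ φ →
      (∀ {x} → x ∈ xs → φ x ∈ xs) → (∀ {y} → y ∈ xs → ∃[ x ] (x ∈ xs × φ x S.≈ y)) →
      Congruent S._≈_ _≈_ g →
      ∏ xs (λ x → g (φ x)) ≈ ∏ xs g
    ∏-permute {xs} φ g !xs φ-cong φ-inj φ-into φ-onto g-cong = begin
      ∏ xs (λ x → g (φ x))                              ≈⟨ ∏-congᴬ (All.tabulateₛ S.setoid (sym ∘ image)) ⟩
      ∏ xs (λ x → ∏ xs (λ y → when (y S.≟ φ x) (g y)))  ≈⟨ ∏-swap xs xs _ ⟩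
      ∏ xs (λ y → ∏ xs (λ x → when (y S.≟ φ x) (g y)))  ≈⟨ ∏-congᴬ (All.tabulateₛ S.setoid preimage) ⟩
      ∏ xs g                                            ∎
      where
      image : ∀ {x} → x ∈ xs → ∏ xs (λ y → when (y S.≟ φ x) (g y)) ≈ g (φ x)
      image x∈xs = ∏-when-unique S.setoid (S._≟ _) g !xs (Any.map S.sym (φ-into x∈xs)) S.refl id g-cong

      preimage : ∀ {y} → y ∈ xs → ∏ xs (λ x → when (y S.≟ φ x) (g y)) ≈ g y
      preimage {y} y∈xs with φ-onto y∈xs
      ... | x₀ , x₀∈xs , φx₀≈y = ∏-when-unique S.setoid (λ x → y S.≟ φ x) (λ _ → g y) !xs
        (Any.map (λ x₀≈x → S.trans (S.sym φx₀≈y) (φ-cong x₀≈x)) x₀∈xs) (S.sym φx₀≈y)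
        (λ y≈φx → φ-inj (S.trans (S.sym y≈φx) (S.sym φx₀≈y))) (λ _ → refl)

module Counting where
  open import Data.Nat using (_+_; _*_)
  open import Data.Nat.Properties using (+-0-commutativeMonoid; *-zeroʳ; *-distribˡ-+; *-comm; +-mono-≤)

  open BigOperator +-0-commutativeMonoid public
    using (when)
    renaming ( ∏ to Σ; ∏-cong to Σ-cong; ∏-congᴬ to Σ-congᴬ; ∏-ε to Σ-0; ∏-∙ to Σ-+; ∏-swap to Σ-swap
             ; ∏-cartesianProduct to Σ-cartesianProduct; ∏-when-none to Σ-𝟙-none; ∏-when-unique to Σ-𝟙-unique)

  private variable
    a b p q : Level
    A : Set a
    B : Set b
    P : Set p
    Q : Set q

  𝟙 : Dec P → ℕ
  𝟙 P? = when P? 1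

  𝟙-yes : (P? : Dec P) → P → 𝟙 P? ≡ 1
  𝟙-yes (yes _) _ = ≡.refl
  𝟙-yes (no ¬p) p = ⊥-elim (¬p p)

  𝟙-no : (P? : Dec P) → ¬ P → 𝟙 P? ≡ 0
  𝟙-no (yes p) ¬p = ⊥-elim (¬p p)
  𝟙-no (no _)  _  = ≡.refl

  𝟙-cong : (P? : Dec P) (Q? : Dec Q) → (P → Q) → (Q → P) → 𝟙 P? ≡ 𝟙 Q?
  𝟙-cong (yes p)  Q? P→Q _   = ≡.sym (𝟙-yes Q? (P→Q p))
  𝟙-cong (no ¬p) Q? _   Q→P = ≡.sym (𝟙-no Q? (¬p ∘ Q→P))

  𝟙-× : (P? : Dec P) (Q? : Dec Q) → 𝟙 (P? ×-dec Q?) ≡ 𝟙 P? * 𝟙 Q?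
  𝟙-× (yes _) (yes _) = ≡.refl
  𝟙-× (yes _) (no _)  = ≡.refl
  𝟙-× (no _)  _       = ≡.refl

  𝟙-+-𝟙¬ : (P? : Dec P) → 𝟙 P? + 𝟙 (¬? P?) ≡ 1
  𝟙-+-𝟙¬ (yes _) = ≡.refl
  𝟙-+-𝟙¬ (no _)  = ≡.refl

  Σ-length : ∀ (xs : List A) → Σ xs (λ _ → 1) ≡ length xs
  Σ-length []       = ≡.refl
  Σ-length (x ∷ xs) = ≡.cong suc (Σ-length xs)

  Σ-const : ∀ (xs : List A) k → Σ xs (λ _ → k) ≡ length xs * k
  Σ-const []       k = ≡.refl
  Σ-const (x ∷ xs) k = ≡.cong (k +_) (Σ-const xs k)

  Σ-*ˡ : ∀ (xs : List A) k (f : A → ℕ) → Σ xs (λ x → k * f x) ≡ k * Σ xs f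
  Σ-*ˡ []       k f = ≡.sym (*-zeroʳ k)
  Σ-*ˡ (x ∷ xs) k f = ≡.trans (≡.cong (k * f x +_) (Σ-*ˡ xs k f)) (≡.sym (*-distribˡ-+ k (f x) _))

  Σ-*ʳ : ∀ (xs : List A) k (f : A → ℕ) → Σ xs (λ x → f x * k) ≡ Σ xs f * k
  Σ-*ʳ xs k f = ≡.trans (Σ-cong xs (λ x → *-comm (f x) k)) (≡.trans (Σ-*ˡ xs k f) (*-comm k _))

  Σ-≤ : ∀ {xs : List A} {f g : A → ℕ} → All (λ x → f x ≤ g x) xs → Σ xs f ≤ Σ xs g
  Σ-≤ []            = z≤n
  Σ-≤ (fx≤gx ∷ les) = +-mono-≤ fx≤gx (Σ-≤ les)

  length-filter : ∀ {P : Pred A p} (P? : Decidable P) xs → length (filter P? xs) ≡ Σ xs (λ x → 𝟙 (P? x))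
  length-filter P? []       = ≡.refl
  length-filter P? (x ∷ xs) with P? x
  ... | yes _ = ≡.cong suc (length-filter P? xs)
  ... | no  _ = length-filter P? xs

  length-cartesianProduct : ∀ (xs : List A) (ys : List B) →
    length (cartesianProduct xs ys) ≡ length xs * length ys
  length-cartesianProduct xs ys = begin
    length (cartesianProduct xs ys)       ≡⟨ Σ-length (cartesianProduct xs ys) ⟨
    Σ (cartesianProduct xs ys) (λ _ → 1)  ≡⟨ Σ-cartesianProduct xs ys _ ⟩
    Σ xs (λ _ → Σ ys (λ _ → 1))           ≡⟨ Σ-cong xs (λ _ → Σ-length ys) ⟩
    Σ xs (λ _ → length ys)                ≡⟨ Σ-const xs _ ⟩
    length xs * length ys                 ∎
    where open ≡.≡-Reasoning

module Selection {a c ℓ} {A : Set a} (S : DecSetoid c ℓ) (key : A → DecSetoid.Carrier S) (k : ℕ) where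
  open DecSetoid S
  open Counting

  count : Carrier → List A → ℕ
  count b xs = Σ xs (λ x → 𝟙 (key x ≟ b))

  private
    keepIf : ∀ {p} {P : Set p} → Dec P → A → List A → List A
    keepIf (yes _) x xs = x ∷ xs
    keepIf (no _)  x xs = xs

  select : List A → List A
  select []       = []
  select (x ∷ xs) = keepIf (count (key x) (select xs) <? k) x (select xs)

  count-cong : ∀ {b b′} xs → b ≈ b′ → count b xs ≡ count b′ xs
  count-cong xs b≈b′ = Σ-cong xs (λ x → 𝟙-cong (key x ≟ _) (key x ≟ _)
    (λ e → trans e b≈b′) (λ e → trans e (sym b≈b′)))

  private
    suc-⊓ : ∀ m n → m ⊓ n < m → suc (m ⊓ n) ≡ m ⊓ suc n
    suc-⊓ (suc m) zero    _        = ≡.cong suc (≡.sym (ℕ.⊓-zeroʳ m))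
    suc-⊓ (suc m) (suc n) (s≤s lt) = ≡.cong suc (suc-⊓ m n lt)

    ⊓-saturated : ∀ m n → ¬ (m ⊓ n < m) → m ⊓ n ≡ m ⊓ suc n
    ⊓-saturated zero    n       _    = ≡.refl
    ⊓-saturated (suc m) zero    full = ⊥-elim (full (s≤s z≤n))
    ⊓-saturated (suc m) (suc n) full = ≡.cong suc (⊓-saturated m n (full ∘ s≤s))

  count-select : ∀ b xs → count b (select xs) ≡ k ⊓ count b xs

  private
    count-select-class : ∀ {x b} xs → key x ≈ b → count (key x) (select xs) ≡ k ⊓ count b xs
    count-select-class xs x∼b = ≡.trans (count-cong (select xs) x∼b) (count-select _ xs)

  count-select b []       = ≡.sym (ℕ.⊓-zeroʳ k)
  count-select b (x ∷ xs) with count (key x) (select xs) <? k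
  ... | yes room with key x ≟ b
  ...   | yes x∼b = ≡.trans (≡.cong suc (count-select b xs))
                            (suc-⊓ k _ (≡.subst (_< k) (count-select-class xs x∼b) room))
  ...   | no  _   = count-select b xs
  count-select b (x ∷ xs) | no full with key x ≟ b
  ...   | yes x∼b = ≡.trans (count-select b xs)
                            (⊓-saturated k _ (≡.subst (λ n → ¬ n < k) (count-select-class xs x∼b) full))
  ...   | no  _   = count-select b xs

  select⁺ : ∀ {p} {P : Pred A p} {xs} → All P xs → All P (select xs)
  select⁺ {xs = []}     []         = []
  select⁺ {xs = x ∷ xs} (px ∷ pxs) with count (key x) (select xs) <? k
  ... | yes _ = px ∷ select⁺ pxs
  ... | no  _ = select⁺ pxs

  selectᴬᴾ⁺ : ∀ {r} {R : A → A → Set r} {xs} → AllPairs R xs → AllPairs R (select xs)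
  selectᴬᴾ⁺ {xs = []}     []         = []
  selectᴬᴾ⁺ {xs = x ∷ xs} (rx ∷ rxs) with count (key x) (select xs) <? k
  ... | yes _ = select⁺ rx ∷ selectᴬᴾ⁺ rxs
  ... | no  _ = selectᴬᴾ⁺ rxs

module FieldProperties {c ℓ} (F : FiniteField c ℓ) where
  open FiniteField F
  open ≈-Reasoning setoid
  open ExpProperties commutativeSemiring using (_^_; ^-congˡ; ^-assocʳ; ^-distrib-*)

  decSetoid : DecSetoid c ℓ
  decSetoid = record { isDecEquivalence = record { isEquivalence = isEquivalence ; _≟_ = _≟_ } }

  *-cancelʳ : ∀ {x y u} → u ≉ 0# → x * u ≈ y * u → x ≈ y
  *-cancelʳ {x} {y} {u} u≉0 xu≈yu with inverse u u≉0
  ... | u⁻¹ , uu⁻¹≈1 = begin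
    x              ≈⟨ unit x ⟨
    (x * u) * u⁻¹  ≈⟨ *-cong xu≈yu refl ⟩
    (y * u) * u⁻¹  ≈⟨ unit y ⟩
    y              ∎
    where
    unit : ∀ z → (z * u) * u⁻¹ ≈ z
    unit z = trans (*-assoc z u u⁻¹) (trans (*-cong refl uu⁻¹≈1) (*-identityʳ z))

  *-nonzero : ∀ {x y} → x ≉ 0# → y ≉ 0# → x * y ≉ 0#
  *-nonzero {x} {y} x≉0 y≉0 xy≈0 = x≉0 (*-cancelʳ y≉0 (trans xy≈0 (sym (zeroˡ y))))

  divide : ∀ {u} → u ≉ 0# → ∀ z → ∃[ x ] (x * u ≈ z)
  divide {u} u≉0 z with inverse u u≉0
  ... | u⁻¹ , uu⁻¹≈1 = z * u⁻¹ , (begin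
    (z * u⁻¹) * u  ≈⟨ *-assoc z u⁻¹ u ⟩
    z * (u⁻¹ * u)  ≈⟨ *-cong refl (trans (*-comm u⁻¹ u) uu⁻¹≈1) ⟩
    z * 1#         ≈⟨ *-identityʳ z ⟩
    z              ∎)

  nonzero? : Decidable (_≉ 0#)
  nonzero? x = ¬? (x ≟ 0#)

  nonzero-resp : (_≉ 0#) Respects _≈_
  nonzero-resp x≈y x≉0 y≈0 = x≉0 (trans x≈y y≈0)

  pow≡^ : ∀ x n → pow x n ≡ x ^ n
  pow≡^ x zero    = ≡.refl
  pow≡^ x (suc n) = ≡.cong (x *_) (pow≡^ x n)

  pow-cong : ∀ n {x y} → x ≈ y → pow x n ≈ pow y n
  pow-cong n {x} {y} x≈y = begin
    pow x n  ≡⟨ pow≡^ x n ⟩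
    x ^ n    ≈⟨ ^-congˡ n x≈y ⟩
    y ^ n    ≡⟨ pow≡^ y n ⟨
    pow y n  ∎

  pow-distrib-* : ∀ x y n → pow (x * y) n ≈ pow x n * pow y n
  pow-distrib-* x y n = begin
    pow (x * y) n      ≡⟨ pow≡^ (x * y) n ⟩
    (x * y) ^ n        ≈⟨ ^-distrib-* x y n ⟩
    x ^ n * y ^ n      ≡⟨ ≡.cong₂ _*_ (pow≡^ x n) (pow≡^ y n) ⟨
    pow x n * pow y n  ∎

  pow-pow : ∀ x m n → pow (pow x m) n ≈ pow x (m *ℕ n)
  pow-pow x m n = begin
    pow (pow x m) n  ≡⟨ ≡.trans (pow≡^ (pow x m) n) (≡.cong (_^ n) (pow≡^ x m)) ⟩
    (x ^ m) ^ n      ≈⟨ ^-assocʳ x m n ⟩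
    x ^ (m *ℕ n)     ≡⟨ pow≡^ x (m *ℕ n) ⟨
    pow x (m *ℕ n)   ∎

  pow-1# : ∀ n → pow 1# n ≈ 1#
  pow-1# zero    = refl
  pow-1# (suc n) = trans (*-identityˡ _) (pow-1# n)

  pow-0# : ∀ n .{{_ : NonZero n}} → pow 0# n ≈ 0#
  pow-0# (suc n) = zeroˡ _

  pow-nonzero : ∀ n {x} → x ≉ 0# → pow x n ≉ 0#
  pow-nonzero zero    x≉0 = 0≉1 ∘ sym
  pow-nonzero (suc n) x≉0 = *-nonzero x≉0 (pow-nonzero n x≉0)

module MonicPolynomial {c ℓ} (F : FiniteField c ℓ) where
  open FiniteField F
  open FieldProperties F
  open ≈-Reasoning setoid
  open RingSolver (ACR.fromCommutativeRing commRing (λ _ → nothing)) using (solve; _⊕_; _⊗_; _⊜_)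

  -- [c₀, …, cₙ₋₁] stands for the monic polynomial c₀ + c₁X + ⋯ + cₙ₋₁Xⁿ⁻¹ + Xⁿ.
  evalMonic : List Carrier → Carrier → Carrier
  evalMonic []       x = 1#
  evalMonic (c ∷ cs) x = c + x * evalMonic cs x

  -- the quotient of the division by X - r, by Horner's scheme
  quotient : Carrier → List Carrier → List Carrier
  quotient r []            = []
  quotient r (c ∷ [])      = []
  quotient r (c ∷ c′ ∷ cs) = evalMonic (c′ ∷ cs) r ∷ quotient r (c′ ∷ cs)

  length-quotient : ∀ r c cs → length (quotient r (c ∷ cs)) ≡ length cs
  length-quotient r c []        = ≡.refl
  length-quotient r c (c′ ∷ cs) = ≡.cong suc (length-quotient r c′ cs)

  -- p(x) = (x - r) q(x) + p(r), stated without subtraction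
  division : ∀ r c cs x →
    evalMonic (c ∷ cs) x + r * evalMonic (quotient r (c ∷ cs)) x
      ≈ x * evalMonic (quotient r (c ∷ cs)) x + evalMonic (c ∷ cs) r
  division r c []        x = solve 4 (λ c x r i → (c ⊕ x ⊗ i ⊕ r ⊗ i) ⊜ (x ⊗ i ⊕ (c ⊕ r ⊗ i))) refl c x r 1#
  division r c (c′ ∷ cs) x = begin
    (c + x * E) + r * (P + x * Q)  ≈⟨ solve 6 (λ c x r E P Q → (c ⊕ x ⊗ E ⊕ r ⊗ (P ⊕ x ⊗ Q))
                                                             ⊜ (c ⊕ r ⊗ P ⊕ x ⊗ (E ⊕ r ⊗ Q))) refl c x r E P Q ⟩
    (c + r * P) + x * (E + r * Q)  ≈⟨ +-cong refl (*-cong refl (division r c′ cs x)) ⟩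
    (c + r * P) + x * (x * Q + P)  ≈⟨ solve 5 (λ c x r P Q → (c ⊕ r ⊗ P ⊕ x ⊗ (x ⊗ Q ⊕ P))
                                                           ⊜ (x ⊗ (P ⊕ x ⊗ Q) ⊕ (c ⊕ r ⊗ P))) refl c x r P Q ⟩
    x * (P + x * Q) + (c + r * P)  ∎
    where
    E P Q : Carrier
    E = evalMonic (c′ ∷ cs) x
    P = evalMonic (c′ ∷ cs) r
    Q = evalMonic (quotient r (c′ ∷ cs)) x

  quotient-root : ∀ {r s} c cs → evalMonic (c ∷ cs) r ≈ 0# → evalMonic (c ∷ cs) s ≈ 0# → r ≉ s →
    evalMonic (quotient r (c ∷ cs)) s ≈ 0#
  quotient-root {r} {s} c cs pr≈0 ps≈0 r≉s with evalMonic (quotient r (c ∷ cs)) s ≟ 0#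
  ... | yes q≈0 = q≈0
  ... | no  q≉0 = ⊥-elim (r≉s (*-cancelʳ q≉0 (begin
    r * q       ≈⟨ +-identityˡ _ ⟨
    0# + r * q  ≈⟨ +-cong ps≈0 refl ⟨
    ps + r * q  ≈⟨ division r c cs s ⟩
    s * q + pr  ≈⟨ +-cong refl pr≈0 ⟩
    s * q + 0#  ≈⟨ +-identityʳ _ ⟩
    s * q       ∎)))
    where
    q ps pr : Carrier
    q  = evalMonic (quotient r (c ∷ cs)) s
    ps = evalMonic (c ∷ cs) s
    pr = evalMonic (c ∷ cs) r

  roots-bound : ∀ cs {rs} → Unique setoid rs → All (λ r → evalMonic cs r ≈ 0#) rs → length rs ≤ length cs
  roots-bound cs       {[]}     _            _                = z≤n
  roots-bound []       {r ∷ rs} _            (1≈0 ∷ _)        = ⊥-elim (0≉1 (sym 1≈0))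
  roots-bound (c ∷ cs) {r ∷ rs} (r∉rs ∷ !rs) (pr≈0 ∷ prs≈0) =
    ℕ.≤-trans (s≤s (roots-bound (quotient r (c ∷ cs)) !rs qrs≈0))
              (ℕ.≤-reflexive (≡.cong suc (length-quotient r c cs)))
    where
    qrs≈0 : All (λ s → evalMonic (quotient r (c ∷ cs)) s ≈ 0#) rs
    qrs≈0 = All.zipWith (λ (ps≈0 , r≉s) → quotient-root c cs pr≈0 ps≈0 r≉s) (prs≈0 , r∉rs)

  evalMonic-Xⁿ : ∀ n x → evalMonic (replicate n 0#) x ≈ pow x n
  evalMonic-Xⁿ zero    x = refl
  evalMonic-Xⁿ (suc n) x = trans (+-identityˡ _) (*-cong refl (evalMonic-Xⁿ n x))

  roots-of-unity-bound : ∀ n .{{_ : NonZero n}} {rs} → Unique setoid rs → All (λ r → pow r n ≈ 1#) rs →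
    length rs ≤ n
  roots-of-unity-bound (suc n) !rs rsⁿ≈1 = ℕ.≤-trans
    (roots-bound (- 1# ∷ replicate n 0#) !rs (All.map root rsⁿ≈1)) (ℕ.≤-reflexive (≡.cong suc (length-replicate n)))
    where
    root : ∀ {r} → pow r (suc n) ≈ 1# → evalMonic (- 1# ∷ replicate n 0#) r ≈ 0#
    root {r} rⁿ≈1 = begin
      - 1# + r * evalMonic (replicate n 0#) r  ≈⟨ +-cong refl (*-cong refl (evalMonic-Xⁿ n r)) ⟩
      - 1# + pow r (suc n)                     ≈⟨ +-cong refl rⁿ≈1 ⟩
      - 1# + 1#                                ≈⟨ -‿inverseˡ 1# ⟩
      0#                                       ∎

module Units {c ℓ} (F : FiniteField c ℓ) where
  open FiniteField F
  open FieldProperties F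
  open Counting
  open SetoidMembership setoid using (_∈_)

  units : List Carrier
  units = filter nonzero? elements

  units-unique : Unique setoid units
  units-unique = AllPairsProperties.filter⁺ nonzero? distinct

  units-nonzero : All (_≉ 0#) units
  units-nonzero = AllProperties.all-filter nonzero? elements

  ∈-units : ∀ {x} → x ≉ 0# → x ∈ units
  ∈-units {x} = SetoidMembershipProperties.∈-filter⁺ setoid nonzero? nonzero-resp (complete x)

  ∈-units⁻ : ∀ {x} → x ∈ units → x ≉ 0#
  ∈-units⁻ x∈units =
    proj₂ (SetoidMembershipProperties.∈-filter⁻ setoid nonzero? nonzero-resp {xs = elements} x∈units)

  |units|-nonZero : NonZero (length units)
  |units|-nonZero = nonZero (∈-units (0≉1 ∘ sym))
    where
    nonZero : ∀ {x xs} → x ∈ xs → NonZero (length xs)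
    nonZero {xs = _ ∷ _} _ = _

  size≡1+|units| : size ≡ suc (length units)
  size≡1+|units| = begin
    length elements                                             ≡⟨ Σ-length elements ⟨
    Σ elements (λ x → 1)                                        ≡⟨ Σ-cong elements (λ x → 𝟙-+-𝟙¬ (x ≟ 0#)) ⟨
    Σ elements (λ x → 𝟙 (x ≟ 0#) +ℕ 𝟙 (nonzero? x))             ≡⟨ Σ-+ elements _ _ ⟩
    Σ elements (λ x → 𝟙 (x ≟ 0#)) +ℕ Σ elements (𝟙 ∘ nonzero?)
      ≡⟨ ≡.cong₂ _+ℕ_ once (length-filter nonzero? elements) ⟨
    suc (length units)                                          ∎
    where
    open ≡.≡-Reasoning
    once : 1 ≡ Σ elements (λ x → 𝟙 (x ≟ 0#))
    once = ≡.sym (Σ-𝟙-unique setoid (_≟ 0#) (λ _ → 1) distinct (Any.map sym (complete 0#)) refl id (λ _ → ≡.refl))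

  open BigOperator *-commutativeMonoid using (∏; ∏-∙; ∏-permute)

  ∏-const : ∀ {a} {A : Set a} (xs : List A) u → ∏ xs (λ _ → u) ≈ pow u (length xs)
  ∏-const []       u = refl
  ∏-const (x ∷ xs) u = *-cong refl (∏-const xs u)

  ∏-nonzero : ∀ {xs} → All (_≉ 0#) xs → ∏ xs id ≉ 0#
  ∏-nonzero []           = 0≉1 ∘ sym
  ∏-nonzero (x≉0 ∷ xs≉0) = *-nonzero x≉0 (∏-nonzero xs≉0)

  fermat : ∀ {u} → u ≉ 0# → pow u (length units) ≈ 1#
  fermat {u} u≉0 = *-cancelʳ (∏-nonzero units-nonzero) (begin
    pow u (length units) * ∏ units id  ≈⟨ *-comm _ _ ⟩
    ∏ units id * pow u (length units)  ≈⟨ *-cong refl (∏-const units u) ⟨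
    ∏ units id * ∏ units (λ _ → u)     ≈⟨ ∏-∙ units id (λ _ → u) ⟨
    ∏ units (λ x → x * u)              ≈⟨ ∏-permute decSetoid (_* u) id units-unique (λ x≈y → *-cong x≈y refl)
                                            (*-cancelʳ u≉0) into onto id ⟩
    ∏ units id                         ≈⟨ *-identityˡ _ ⟨
    1# * ∏ units id                    ∎)
    where
    open ≈-Reasoning setoid
    into : ∀ {x} → x ∈ units → x * u ∈ units
    into x∈units = ∈-units (*-nonzero (∈-units⁻ x∈units) u≉0)
    onto : ∀ {y} → y ∈ units → ∃[ x ] (x ∈ units × x * u ≈ y)
    onto {y} y∈units with divide u≉0 y
    ... | x , xu≈y = x , ∈-units (λ x≈0 → ∈-units⁻ y∈units (trans (sym xu≈y) (trans (*-cong x≈0 refl) (zeroˡ u))))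
                       , xu≈y

module RootsOfUnity {c ℓ} (F : FiniteField c ℓ) (d : ℕ) .{{_ : NonZero d}} where
  open FiniteField F
  open FieldProperties F
  open MonicPolynomial F using (roots-of-unity-bound)
  open Units F
  open Counting
  open SetoidMembership setoid using (_∈_)

  μ? : Decidable (λ x → pow x d ≈ 1#)
  μ? x = pow x d ≟ 1#

  μ-resp : (λ x → pow x d ≈ 1#) Respects _≈_
  μ-resp x≈y xᵈ≈1 = trans (pow-cong d (sym x≈y)) xᵈ≈1

  μ : List Carrier
  μ = filter μ? elements

  μ-unique : Unique setoid μ
  μ-unique = AllPairsProperties.filter⁺ μ? distinct

  μ-roots : All (λ x → pow x d ≈ 1#) μ
  μ-roots = AllProperties.all-filter μ? elements

  ∈-μ : ∀ {x} → pow x d ≈ 1# → x ∈ μ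
  ∈-μ {x} = SetoidMembershipProperties.∈-filter⁺ setoid μ? μ-resp (complete x)

  root-nonzero : ∀ {x} → pow x d ≈ 1# → x ≉ 0#
  root-nonzero xᵈ≈1 x≈0 = 0≉1 (trans (sym (pow-0# d)) (trans (pow-cong d (sym x≈0)) xᵈ≈1))

  μ-nonzero : All (_≉ 0#) μ
  μ-nonzero = All.map root-nonzero μ-roots

  |μ|≤d : length μ ≤ d
  |μ|≤d = roots-of-unity-bound d μ-unique μ-roots

  μ-solutions : ∀ {y} z → y ≉ 0# → Σ μ (λ c → 𝟙 ((c * y) ≟ z)) ≡ 𝟙 (pow y d ≟ pow z d)
  μ-solutions {y} z y≉0 with divide y≉0 z | pow y d ≟ pow z d
  ... | x , xy≈z | yes yᵈ≈zᵈ = Σ-𝟙-unique setoid (λ c → (c * y) ≟ z) (λ _ → 1) μ-unique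
    (Any.map (λ x≈c → trans (*-cong (sym x≈c) refl) xy≈z) (∈-μ xᵈ≈1))
    xy≈z (λ cy≈z → *-cancelʳ y≉0 (trans cy≈z (sym xy≈z))) (λ _ → ≡.refl)
    where
    open ≈-Reasoning setoid
    xᵈ≈1 : pow x d ≈ 1#
    xᵈ≈1 = *-cancelʳ (pow-nonzero d y≉0) (begin
      pow x d * pow y d  ≈⟨ pow-distrib-* x y d ⟨
      pow (x * y) d      ≈⟨ pow-cong d xy≈z ⟩
      pow z d            ≈⟨ yᵈ≈zᵈ ⟨
      pow y d            ≈⟨ *-identityˡ _ ⟨
      1# * pow y d       ∎)
  ... | _ | no yᵈ≉zᵈ = Σ-𝟙-none setoid (λ c → (c * y) ≟ z) (λ _ → 1) (All.map ¬solution μ-roots)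
    where
    open ≈-Reasoning setoid
    ¬solution : ∀ {c} → pow c d ≈ 1# → c * y ≉ z
    ¬solution {c} cᵈ≈1 cy≈z = yᵈ≉zᵈ (begin
      pow y d            ≈⟨ *-identityˡ _ ⟨
      1# * pow y d       ≈⟨ *-cong cᵈ≈1 refl ⟨
      pow c d * pow y d  ≈⟨ pow-distrib-* c y d ⟨
      pow (c * y) d      ≈⟨ pow-cong d cy≈z ⟩
      pow z d            ∎)

  -- {x | xᵈ ≈ uᵈ} is the coset u μ
  coset-size : ∀ {u} → u ≉ 0# → Σ units (λ x → 𝟙 (pow x d ≟ pow u d)) ≡ length μ
  coset-size {u} u≉0 = begin
    Σ units (λ x → 𝟙 (pow x d ≟ pow u d))        ≡⟨ Σ-cong units (λ x → 𝟙-cong (pow x d ≟ _) (pow u d ≟ _) sym sym) ⟩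
    Σ units (λ x → 𝟙 (pow u d ≟ pow x d))        ≡⟨ Σ-cong units (λ x → μ-solutions x u≉0) ⟨
    Σ units (λ x → Σ μ (λ c → 𝟙 ((c * u) ≟ x)))  ≡⟨ Σ-swap units μ _ ⟩
    Σ μ (λ c → Σ units (λ x → 𝟙 ((c * u) ≟ x)))  ≡⟨ Σ-congᴬ (All.map once μ-nonzero) ⟩
    Σ μ (λ _ → 1)                                ≡⟨ Σ-length μ ⟩
    length μ                                     ∎
    where
    open ≡.≡-Reasoning
    once : ∀ {c} → c ≉ 0# → Σ units (λ x → 𝟙 ((c * u) ≟ x)) ≡ 1
    once c≉0 = Σ-𝟙-unique setoid (_ ≟_) (λ _ → 1) units-unique (∈-units (*-nonzero c≉0 u≉0)) refl sym (λ _ → ≡.refl)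

module SubgroupOrder {c ℓ} (F : FiniteField c ℓ) (d m : ℕ) .{{_ : NonZero d}}
                     (|units|≡md : length (Units.units F) ≡ m *ℕ d) where
  open FiniteField F
  open FieldProperties F
  open Units F
  open Counting
  open RootsOfUnity F d

  instance
    m-nonZero : NonZero m
    m-nonZero = ℕ.m*n≢0⇒m≢0 m {{≡.subst NonZero |units|≡md |units|-nonZero}}

  module μₘ = RootsOfUnity F m

  -- By Fermat x^(dm) = x^(q-1) = 1, so x^d is an m-th root of unity.
  power-in-μₘ : ∀ {x} → x ≉ 0# → Σ μₘ.μ (λ y → 𝟙 (pow x d ≟ y)) ≡ 1
  power-in-μₘ {x} x≉0 =
    Σ-𝟙-unique setoid (pow x d ≟_) (λ _ → 1) μₘ.μ-unique (μₘ.∈-μ xᵈᵐ≈1) refl sym (λ _ → ≡.refl)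
    where
    xᵈᵐ≈1 : pow (pow x d) m ≈ 1#
    xᵈᵐ≈1 = trans (pow-pow x d m) (trans (reflexive (≡.cong (pow x) dm≡|units|)) (fermat x≉0))
      where
      dm≡|units| : d *ℕ m ≡ length units
      dm≡|units| = ≡.trans (ℕ.*-comm d m) (≡.sym |units|≡md)

  fibre≤ : ∀ y → Σ units (λ x → 𝟙 (pow x d ≟ y)) ≤ length μ
  fibre≤ y with Any.any? (λ x → pow x d ≟ y) units
  ... | yes ∃x = ℕ.≤-reflexive (≡.trans (Σ-cong units (λ x → 𝟙-cong (pow x d ≟ y) (pow x d ≟ pow x₀ d) to from))
                                        (coset-size x₀≉0))
    where
    x₀ : Carrier
    x₀ = Any.lookup ∃x
    x₀≉0 : x₀ ≉ 0#
    x₀≉0 = proj₁ (All.lookupAny units-nonzero ∃x)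
    x₀ᵈ≈y : pow x₀ d ≈ y
    x₀ᵈ≈y = proj₂ (All.lookupAny units-nonzero ∃x)
    to : ∀ {x} → pow x d ≈ y → pow x d ≈ pow x₀ d
    to e = trans e (sym x₀ᵈ≈y)
    from : ∀ {x} → pow x d ≈ pow x₀ d → pow x d ≈ y
    from e = trans e x₀ᵈ≈y
  ... | no ∄x = ≡.subst (_≤ length μ) (≡.sym none) z≤n
    where
    none : Σ units (λ x → 𝟙 (pow x d ≟ y)) ≡ 0
    none = Σ-𝟙-none setoid (λ x → pow x d ≟ y) (λ _ → 1) (AllProperties.¬Any⇒All¬ units ∄x)

  d≤|μ| : d ≤ length μ
  d≤|μ| = ℕ.*-cancelˡ-≤ m (begin
    m *ℕ d                                          ≡⟨ |units|≡md ⟨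
    length units                                    ≡⟨ Σ-length units ⟨
    Σ units (λ _ → 1)                               ≡⟨ Σ-congᴬ (All.map power-in-μₘ units-nonzero) ⟨
    Σ units (λ x → Σ μₘ.μ (λ y → 𝟙 (pow x d ≟ y)))  ≡⟨ Σ-swap units μₘ.μ _ ⟩
    Σ μₘ.μ (λ y → Σ units (λ x → 𝟙 (pow x d ≟ y)))  ≤⟨ Σ-≤ (All.universal fibre≤ μₘ.μ) ⟩
    Σ μₘ.μ (λ _ → length μ)                         ≡⟨ Σ-const μₘ.μ _ ⟩
    length μₘ.μ *ℕ length μ                         ≤⟨ ℕ.*-monoˡ-≤ (length μ) μₘ.|μ|≤d ⟩
    m *ℕ length μ                                   ∎)
    where open ℕ.≤-Reasoning

  |μ|≡d : length μ ≡ d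
  |μ|≡d = ℕ.≤-antisym |μ|≤d d≤|μ|

module CosetPairs {c ℓ} (F : FiniteField c ℓ) (d m : ℕ) .{{_ : NonZero d}} (2≤d : 2 ≤ d)
                  (|units|≡md : length (Units.units F) ≡ m *ℕ d) where
  open FiniteField F
  open FieldProperties F
  open Units F
  open Counting
  open RootsOfUnity F d
  open SubgroupOrder F d m |units|≡md using (|μ|≡d)
  open Selection decSetoid (λ x → pow x d) 2 using (count; select; count-select; select⁺; selectᴬᴾ⁺)
  open ≡.≡-Reasoning

  -- two units from each coset of μ
  D : List Carrier
  D = select units

  D-nonzero : All (_≉ 0#) D
  D-nonzero = select⁺ units-nonzero

  D-unique : Unique setoid D
  D-unique = selectᴬᴾ⁺ units-unique

  D-coset : ∀ {w} → w ≉ 0# → count (pow w d) D ≡ 2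
  D-coset {w} w≉0 = begin
    count (pow w d) D          ≡⟨ count-select (pow w d) units ⟩
    2 ⊓ count (pow w d) units  ≡⟨ ≡.cong (2 ⊓_) (≡.trans (coset-size w≉0) |μ|≡d) ⟩
    2 ⊓ d                      ≡⟨ ℕ.m≤n⇒m⊓n≡m 2≤d ⟩
    2                          ∎

  representations : ∀ z → Σ μ (λ c → Σ D (λ y → 𝟙 ((c * y) ≟ z))) ≡ 2 *ℕ 𝟙 (nonzero? z)
  representations z with z ≟ 0#
  ... | no z≉0 = begin
    Σ μ (λ c → Σ D (λ y → 𝟙 ((c * y) ≟ z)))  ≡⟨ Σ-swap μ D _ ⟩
    Σ D (λ y → Σ μ (λ c → 𝟙 ((c * y) ≟ z)))  ≡⟨ Σ-congᴬ (All.map (μ-solutions z) D-nonzero) ⟩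
    Σ D (λ y → 𝟙 (pow y d ≟ pow z d))        ≡⟨ D-coset z≉0 ⟩
    2                                        ∎
  ... | yes z≈0 = ≡.trans (Σ-congᴬ (All.map none μ-nonzero)) (Σ-0 μ)
    where
    none : ∀ {c} → c ≉ 0# → Σ D (λ y → 𝟙 ((c * y) ≟ z)) ≡ 0
    none {c} c≉0 = Σ-𝟙-none setoid (λ y → (c * y) ≟ z) (λ _ → 1)
      (All.map (λ y≉0 cy≈z → *-nonzero c≉0 y≉0 (trans cy≈z z≈0)) D-nonzero)

  |μ|*|D| : length μ *ℕ length D ≡ 2 *ℕ length units
  |μ|*|D| = begin
    length μ *ℕ length D                                          ≡⟨ Σ-const μ (length D) ⟨
    Σ μ (λ _ → length D)                                          ≡⟨ Σ-cong μ (λ _ → Σ-length D) ⟨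
    Σ μ (λ c → Σ D (λ _ → 1))                                     ≡⟨ Σ-cong μ (λ c → Σ-cong D (once c)) ⟨
    Σ μ (λ c → Σ D (λ y → Σ elements (λ z → 𝟙 ((c * y) ≟ z))))  ≡⟨ Σ-cong μ (λ c → Σ-swap D elements _) ⟩
    Σ μ (λ c → Σ elements (λ z → Σ D (λ y → 𝟙 ((c * y) ≟ z))))  ≡⟨ Σ-swap μ elements _ ⟩
    Σ elements (λ z → Σ μ (λ c → Σ D (λ y → 𝟙 ((c * y) ≟ z))))  ≡⟨ Σ-cong elements representations ⟩
    Σ elements (λ z → 2 *ℕ 𝟙 (nonzero? z))                        ≡⟨ Σ-*ˡ elements 2 _ ⟩
    2 *ℕ Σ elements (λ z → 𝟙 (nonzero? z))                        ≡⟨ ≡.cong (2 *ℕ_) (length-filter nonzero? elements) ⟨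
    2 *ℕ length units                                             ∎
    where
    once : ∀ c y → Σ elements (λ z → 𝟙 ((c * y) ≟ z)) ≡ 1
    once c y = Σ-𝟙-unique setoid ((c * y) ≟_) (λ _ → 1) distinct (complete (c * y)) refl sym (λ _ → ≡.refl)

  |D|≡2m : length D ≡ 2 *ℕ m
  |D|≡2m = ℕ.*-cancelˡ-≡ (length D) (2 *ℕ m) d (begin
    d *ℕ length D         ≡⟨ ≡.cong (_*ℕ length D) |μ|≡d ⟨
    length μ *ℕ length D  ≡⟨ |μ|*|D| ⟩
    2 *ℕ length units     ≡⟨ ≡.cong (2 *ℕ_) |units|≡md ⟩
    2 *ℕ (m *ℕ d)         ≡⟨ ℕ.*-assoc 2 m d ⟨
    2 *ℕ m *ℕ d           ≡⟨ ℕ.*-comm (2 *ℕ m) d ⟩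
    d *ℕ (2 *ℕ m)         ∎)

module SumSet {c ℓ} (F : FiniteField c ℓ) (d m : ℕ) .{{_ : NonZero d}} (2≤d : 2 ≤ d)
              (|units|≡md : length (Units.units F) ≡ m *ℕ d) where
  open FiniteField F
  open FieldProperties F
  open Units F
  open Counting
  open RootsOfUnity F d
  open CosetPairs F d m 2≤d |units|≡md
  open AffineGroup F d
  open GroupProperties +-group using (x≈z//y; //-rightDividesˡ; x∙y⁻¹≈ε⇒x≈y; x≈y⇒x∙y⁻¹≈ε)
  open ≡.≡-Reasoning

  μD : List Aff
  μD = cartesianProduct μ D

  T : List Aff
  T = idA ∷ μD

  T-inG : All InG T
  T-inG = pow-1# d ∷ AllProperties.cartesianProduct⁺ setoid setoid μ D
    (λ c∈μ _ → All.lookupₛ setoid μ-resp μ-roots c∈μ)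

  T-unique : AllPairs (λ x y → ¬ (x ≈A y)) T
  T-unique = id∉μD ∷ UniqueProperties.cartesianProduct⁺ setoid setoid μ-unique D-unique
    where
    id∉μD : All (λ y → ¬ (idA ≈A y)) μD
    id∉μD = AllProperties.cartesianProduct⁺ setoid setoid μ D
      (λ _ y∈D (_ , 0≈y) → All.lookupₛ setoid nonzero-resp D-nonzero y∈D (sym 0≈y))

  |T| : length T ≡ suc (2 *ℕ length units)
  |T| = ≡.cong suc (≡.trans (length-cartesianProduct μ D) |μ|*|D|)

  private
    module ≈A = Setoid (setoid ×ₛ setoid)

  ∘A-identityˡ : ∀ x → (idA ∘A x) ≈A x
  ∘A-identityˡ (c , y) = *-identityˡ c , trans (+-identityʳ _) (*-identityˡ y)

  ∘A-identityʳ : ∀ x → (x ∘A idA) ≈A x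
  ∘A-identityʳ (c , y) = *-identityʳ c , trans (+-cong (zeroʳ c) refl) (+-identityˡ y)

  module Representations {a b} (aᵈ≈1 : pow a d ≈ 1#) (g≉id : ¬ ((a , b) ≈A idA)) where
    g : Aff
    g = (a , b)

    b∈D b∉D : ℕ
    b∈D = Σ D (λ y → 𝟙 (y ≟ b))
    b∉D = Σ D (λ y → 𝟙 (¬? (y ≟ b)))

    b∈D+b∉D : b∈D +ℕ b∉D ≡ length D
    b∈D+b∉D = ≡.trans (≡.sym (Σ-+ D _ _)) (≡.trans (Σ-cong D (λ y → 𝟙-+-𝟙¬ (y ≟ b))) (Σ-length D))

    μD-count : Σ μD (λ y → 𝟙 (y ≟A g)) ≡ b∈D
    μD-count = begin
      Σ μD (λ y → 𝟙 (y ≟A g))                            ≡⟨ Σ-cartesianProduct μ D _ ⟩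
      Σ μ (λ c → Σ D (λ y → 𝟙 ((c ≟ a) ×-dec (y ≟ b))))  ≡⟨ Σ-cong μ (λ c → Σ-cong D (𝟙-× (c ≟ a) ∘ (_≟ b))) ⟩
      Σ μ (λ c → Σ D (λ y → 𝟙 (c ≟ a) *ℕ 𝟙 (y ≟ b)))     ≡⟨ Σ-cong μ (λ c → Σ-*ˡ D (𝟙 (c ≟ a)) _) ⟩
      Σ μ (λ c → 𝟙 (c ≟ a) *ℕ b∈D)                       ≡⟨ Σ-*ʳ μ b∈D _ ⟩
      Σ μ (λ c → 𝟙 (c ≟ a)) *ℕ b∈D                       ≡⟨ ≡.cong (_*ℕ b∈D) a-once ⟩
      1 *ℕ b∈D                                           ≡⟨ ℕ.*-identityˡ b∈D ⟩
      b∈D                                                ∎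
      where
      a-once : Σ μ (λ c → 𝟙 (c ≟ a)) ≡ 1
      a-once = Σ-𝟙-unique setoid (_≟ a) (λ _ → 1) μ-unique (Any.map sym (∈-μ aᵈ≈1)) refl id (λ _ → ≡.refl)

    id∘id : 𝟙 ((idA ∘A idA) ≟A g) ≡ 0
    id∘id = 𝟙-no ((idA ∘A idA) ≟A g) (λ e → g≉id (≈A.sym (≈A.trans (≈A.sym (∘A-identityˡ idA)) e)))

    id∘μD : Σ μD (λ y → 𝟙 ((idA ∘A y) ≟A g)) ≡ b∈D
    id∘μD = ≡.trans (Σ-cong μD (λ y → 𝟙-cong ((idA ∘A y) ≟A g) (y ≟A g)
      (≈A.trans (≈A.sym (∘A-identityˡ y))) (≈A.trans (∘A-identityˡ y)))) μD-count

    μD∘id : Σ μD (λ x → 𝟙 ((x ∘A idA) ≟A g)) ≡ b∈D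
    μD∘id = ≡.trans (Σ-cong μD (λ x → 𝟙-cong ((x ∘A idA) ≟A g) (x ≟A g)
      (≈A.trans (≈A.sym (∘A-identityʳ x))) (≈A.trans (∘A-identityʳ x)))) μD-count

    sum-out-c₂ : ∀ {c₁} → pow c₁ d ≈ 1# → ∀ b₁ →
      Σ μ (λ c₂ → Σ D (λ b₂ → 𝟙 (((c₁ * c₂) ≟ a) ×-dec ((c₁ * b₂ + b₁) ≟ b))))
        ≡ Σ D (λ b₂ → 𝟙 ((c₁ * b₂ + b₁) ≟ b))
    sum-out-c₂ {c₁} c₁ᵈ≈1 b₁ = begin
      Σ μ (λ c₂ → Σ D (λ b₂ → 𝟙 (A c₂ ×-dec B b₂)))   ≡⟨ Σ-cong μ (λ c₂ → Σ-cong D (𝟙-× (A c₂) ∘ B)) ⟩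
      Σ μ (λ c₂ → Σ D (λ b₂ → 𝟙 (A c₂) *ℕ 𝟙 (B b₂)))  ≡⟨ Σ-cong μ (λ c₂ → Σ-*ˡ D (𝟙 (A c₂)) _) ⟩
      Σ μ (λ c₂ → 𝟙 (A c₂) *ℕ N)                      ≡⟨ Σ-*ʳ μ N _ ⟩
      Σ μ (λ c₂ → 𝟙 (A c₂)) *ℕ N                      ≡⟨ ≡.cong (_*ℕ N) c₂-once ⟩
      1 *ℕ N                                          ≡⟨ ℕ.*-identityˡ N ⟩
      N                                               ∎
      where
      A : ∀ c₂ → Dec (c₁ * c₂ ≈ a)
      A c₂ = (c₁ * c₂) ≟ a
      B : ∀ b₂ → Dec (c₁ * b₂ + b₁ ≈ b)
      B b₂ = (c₁ * b₂ + b₁) ≟ b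
      N : ℕ
      N = Σ D (λ b₂ → 𝟙 (B b₂))
      c₂-once : Σ μ (λ c₂ → 𝟙 (A c₂)) ≡ 1
      c₂-once = begin
        Σ μ (λ c₂ → 𝟙 ((c₁ * c₂) ≟ a))  ≡⟨ Σ-cong μ (λ c₂ → 𝟙-cong (A c₂) ((c₂ * c₁) ≟ a)
                                             (trans (*-comm c₂ c₁)) (trans (*-comm c₁ c₂))) ⟩
        Σ μ (λ c₂ → 𝟙 ((c₂ * c₁) ≟ a))  ≡⟨ μ-solutions a (root-nonzero c₁ᵈ≈1) ⟩
        𝟙 (pow c₁ d ≟ pow a d)          ≡⟨ 𝟙-yes (pow c₁ d ≟ pow a d) (trans c₁ᵈ≈1 (sym aᵈ≈1)) ⟩
        1                               ∎

    μD∘μD : Σ μD (λ x → Σ μD (λ y → 𝟙 ((x ∘A y) ≟A g))) ≡ 2 *ℕ b∉D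
    μD∘μD = begin
      Σ μD (λ x → Σ μD (λ y → 𝟙 ((x ∘A y) ≟A g)))
        ≡⟨ Σ-cartesianProduct μ D _ ⟩
      Σ μ (λ c₁ → Σ D (λ b₁ → Σ μD (λ y → 𝟙 (((c₁ , b₁) ∘A y) ≟A g))))
        ≡⟨ Σ-congᴬ (All.map sum-out μ-roots) ⟩
      Σ μ (λ c₁ → Σ D (λ b₁ → Σ D (λ b₂ → 𝟙 ((c₁ * b₂ + b₁) ≟ b))))
        ≡⟨ Σ-swap μ D _ ⟩
      Σ D (λ b₁ → Σ μ (λ c₁ → Σ D (λ b₂ → 𝟙 ((c₁ * b₂ + b₁) ≟ b))))
        ≡⟨ Σ-cong D (λ b₁ → Σ-cong μ (λ c₁ → Σ-cong D (shift c₁ b₁))) ⟩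
      Σ D (λ b₁ → Σ μ (λ c₁ → Σ D (λ b₂ → 𝟙 ((c₁ * b₂) ≟ (b - b₁)))))
        ≡⟨ Σ-cong D (λ b₁ → representations (b - b₁)) ⟩
      Σ D (λ b₁ → 2 *ℕ 𝟙 (nonzero? (b - b₁)))
        ≡⟨ Σ-cong D (≡.cong (2 *ℕ_) ∘ nonzero-difference) ⟩
      Σ D (λ b₁ → 2 *ℕ 𝟙 (¬? (b₁ ≟ b)))
        ≡⟨ Σ-*ˡ D 2 _ ⟩
      2 *ℕ b∉D
        ∎
      where
      sum-out : ∀ {c₁} → pow c₁ d ≈ 1# →
        Σ D (λ b₁ → Σ μD (λ y → 𝟙 (((c₁ , b₁) ∘A y) ≟A g)))
          ≡ Σ D (λ b₁ → Σ D (λ b₂ → 𝟙 ((c₁ * b₂ + b₁) ≟ b)))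
      sum-out c₁ᵈ≈1 = Σ-cong D (λ b₁ → ≡.trans (Σ-cartesianProduct μ D _) (sum-out-c₂ c₁ᵈ≈1 b₁))
      shift : ∀ c₁ b₁ b₂ → 𝟙 ((c₁ * b₂ + b₁) ≟ b) ≡ 𝟙 ((c₁ * b₂) ≟ (b - b₁))
      shift c₁ b₁ b₂ = 𝟙-cong ((c₁ * b₂ + b₁) ≟ b) ((c₁ * b₂) ≟ (b - b₁))
        (x≈z//y _ b₁ b) (λ e → trans (+-cong e refl) (//-rightDividesˡ b₁ b))
      nonzero-difference : ∀ b₁ → 𝟙 (nonzero? (b - b₁)) ≡ 𝟙 (¬? (b₁ ≟ b))
      nonzero-difference b₁ = 𝟙-cong (nonzero? (b - b₁)) (¬? (b₁ ≟ b))
        (λ b-b₁≉0 b₁≈b → b-b₁≉0 (x≈y⇒x∙y⁻¹≈ε (sym b₁≈b)))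
        (λ b₁≉b b-b₁≈0 → b₁≉b (sym (x∙y⁻¹≈ε⇒x≈y b b₁ b-b₁≈0)))

    reps-g : reps T g ≡ 4 *ℕ m
    reps-g = begin
      reps T g                                                          ≡⟨ length-filter _ (cartesianProduct T T) ⟩
      Σ (cartesianProduct T T) (λ p → 𝟙 ((proj₁ p ∘A proj₂ p) ≟A g))   ≡⟨ Σ-cartesianProduct T T _ ⟩
      (𝟙 ((idA ∘A idA) ≟A g) +ℕ Σ μD (λ y → 𝟙 ((idA ∘A y) ≟A g)))
        +ℕ Σ μD (λ x → 𝟙 ((x ∘A idA) ≟A g) +ℕ Σ μD (λ y → 𝟙 ((x ∘A y) ≟A g)))
          ≡⟨ ≡.cong₂ _+ℕ_ (≡.cong₂ _+ℕ_ id∘id id∘μD) (≡.trans (Σ-+ μD _ _) (≡.cong₂ _+ℕ_ μD∘id μD∘μD)) ⟩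
      (0 +ℕ b∈D) +ℕ (b∈D +ℕ 2 *ℕ b∉D)                                    ≡⟨ regroup b∈D b∉D ⟩
      2 *ℕ (b∈D +ℕ b∉D)                                                 ≡⟨ ≡.cong (2 *ℕ_) (≡.trans b∈D+b∉D |D|≡2m) ⟩
      2 *ℕ (2 *ℕ m)                                                     ≡⟨ ℕ.*-assoc 2 2 m ⟨
      4 *ℕ m                                                            ∎
      where
      regroup : ∀ x y → (0 +ℕ x) +ℕ (x +ℕ 2 *ℕ y) ≡ 2 *ℕ (x +ℕ y)
      regroup = solve-∀

  reps-T : ∀ g → InG g → ¬ (g ≈A idA) → reps T g ≡ 4 *ℕ m
  reps-T (a , b) = Representations.reps-g

open import Data.Nat using (_*_)

theorem7p3 : ∀ {c ℓ : Level} (F : FiniteField c ℓ) (q d m : ℕ) →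
    IsPrimePower q → FiniteField.size F ≡ q →
    2 ≤ d → q ∸ 1 ≡ m * d →
    ∃[ T ] AffineGroup.IsSumSet F d T (2 * q ∸ 1) (4 * m)
theorem7p3 F q d m _ size≡q 2≤d@(s≤s (s≤s z≤n)) q∸1≡md =
  T , T-inG , T-unique , ≡.trans |T| |T|≡2q∸1 , reps-T
  where
  open Units F using (units; size≡1+|units|)
  q≡1+|units| : q ≡ suc (length units)
  q≡1+|units| = ≡.trans (≡.sym size≡q) size≡1+|units|
  open SumSet F d m 2≤d (≡.trans (≡.cong (_∸ 1) (≡.sym q≡1+|units|)) q∸1≡md)
  |T|≡2q∸1 : suc (2 * length units) ≡ 2 * q ∸ 1
  |T|≡2q∸1 = ≡.trans (≡.cong (_∸ 1) (≡.sym (ℕ.*-suc 2 (length units))))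
                     (≡.cong (λ n → 2 * n ∸ 1) (≡.sym q≡1+|units|))
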